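{- Let $S=\{s_1,s_2,s_3\}$ with $1<s_1<s_2<s_3$ integers and $\gcd(s_1,s_2,s_3)=1$, and suppose $\langle S\rangle$ is not greedy. Let $k$ be the smallest element of $\langle S\rangle$ with $\mathrm{MinCost}_S(k)<\mathrm{GreedyCost}_S(k)$. Then $k=s_2y$ where there exist positive integers $x,y,z$ with $$s_1x+s_3z=s_2y\quad\text{and}\quad y<x+z.$$
   Context: $\langle S\rangle=\{\sum_i a_i s_i : a_i\in\mathbb{N}_0\}$. A representation of $k\in\langle S\rangle$ is a vector $(a_1,a_2,a_3)\in\mathbb{N}_0^3$ with $\sum_i a_i s_i=k$; its cost is $\sum_i a_i$; $\mathrm{MinCost}_S(k)$ is the minimum cost over all representations. The (generalized) greedy representation of $k\in\langle S\rangle$, $k>0$: set $r:=k$; for $i=3,2,1$ let $a_i$ be the largest integer $q\ge0$ with $r-qs_i\in\langle S\rangle$ and replace $r$ by $r-a_is_i$; $\mathrm{GreedyCost}_S(k)=\sum_i a_i$. $\langle S\rangle$ is greedy if $\mathrm{GreedyCost}_S(k)=\mathrm{MinCost}_S(k)$ for all $k\in\langle S\rangle$, $k>0$. -}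

module Defs where

open import Data.Nat using (ℕ; _+_; _*_; _∸_; _≤_; _<_)
open import Data.Product using (Σ; ∃; _×_; _,_)
open import Relation.Binary.PropositionalEquality using (_≡_)

_∈⟨_,_,_⟩ : ℕ → ℕ → ℕ → ℕ → Set
k ∈⟨ s₁ , s₂ , s₃ ⟩ = ∃ λ a₁ → ∃ λ a₂ → ∃ λ a₃ → a₁ * s₁ + a₂ * s₂ + a₃ * s₃ ≡ k

IsRep : ℕ → ℕ → ℕ → ℕ → ℕ → ℕ → ℕ → Set
IsRep s₁ s₂ s₃ k a₁ a₂ a₃ = a₁ * s₁ + a₂ * s₂ + a₃ * s₃ ≡ k

IsMinCost : ℕ → ℕ → ℕ → ℕ → ℕ → Set
IsMinCost s₁ s₂ s₃ k m =
  (∃ λ a₁ → ∃ λ a₂ → ∃ λ a₃ → IsRep s₁ s₂ s₃ k a₁ a₂ a₃ × a₁ + a₂ + a₃ ≡ m)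
  × (∀ a₁ a₂ a₃ → IsRep s₁ s₂ s₃ k a₁ a₂ a₃ → m ≤ a₁ + a₂ + a₃)

Admissible : ℕ → ℕ → ℕ → ℕ → ℕ → ℕ → Set
Admissible s₁ s₂ s₃ s r q = q * s ≤ r × (r ∸ q * s) ∈⟨ s₁ , s₂ , s₃ ⟩

IsLargest : ℕ → ℕ → ℕ → ℕ → ℕ → ℕ → Set
IsLargest s₁ s₂ s₃ s r q =
  Admissible s₁ s₂ s₃ s r q × (∀ q' → Admissible s₁ s₂ s₃ s r q' → q' ≤ q)

IsGreedyCost : ℕ → ℕ → ℕ → ℕ → ℕ → Set
IsGreedyCost s₁ s₂ s₃ k g =
  ∃ λ a₃ → ∃ λ a₂ → ∃ λ a₁ →
    IsLargest s₁ s₂ s₃ s₃ k a₃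
    × IsLargest s₁ s₂ s₃ s₂ (k ∸ a₃ * s₃) a₂
    × IsLargest s₁ s₂ s₃ s₁ (k ∸ a₃ * s₃ ∸ a₂ * s₂) a₁
    × a₁ + a₂ + a₃ ≡ g

IsGreedySemigroup : ℕ → ℕ → ℕ → Set
IsGreedySemigroup s₁ s₂ s₃ =
  ∀ k → 0 < k → k ∈⟨ s₁ , s₂ , s₃ ⟩ → ∀ m g →
    IsMinCost s₁ s₂ s₃ k m → IsGreedyCost s₁ s₂ s₃ k g → g ≡ m

{-# OPTIONS --safe #-}
module Submission where

-- Let b be a minimum-cost and a the greedy representation of k, so cost b < cost a.
-- Among representations with the same number of s₃'s the greedy one is cheapest
-- (with two generators, more of the larger one is cheaper), hence a uses s₃.
-- By minimality of k the greedy representation of k − s₃ is optimal, so no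
-- minimum-cost representation of k uses s₃; in particular b₃ = 0. If a and b
-- shared a generator sⱼ (j ≤ 2), the greedy representation of k − sⱼ would use s₃
-- and be optimal, and adding sⱼ back would give a minimum-cost representation of
-- k using s₃. Finally b is not made of s₁'s only (that is the costliest
-- representation) and a is not made of s₃'s only (the cheapest), which leaves
-- b = (0, y, 0) and a = (x, 0, z).

open import Defs
open import Data.List using (_∷_; [])
open import Data.Nat
  using (ℕ; zero; suc; _+_; _*_; _∸_; _≤_; _<_; z≤n; s≤s; s≤s⁻¹; z<s; _≟_; _≤?_; NonZero; >-nonZero)
open import Data.Nat.GCD using (gcd)
open import Data.Nat.Properties
open import Data.Nat.Tactic.RingSolver using (solve)
open import Data.Product using (∃; _×_; _,_; proj₁)
open import Relation.Nullary using (¬_; yes; no; contradiction)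
open import Relation.Nullary.Decidable using (map′; _×-dec_)
open import Relation.Unary using (Decidable)
open import Relation.Binary.PropositionalEquality
  using (_≡_; refl; sym; trans; cong; cong₂; subst; subst₂)

∃-largest : {P : ℕ → Set} → Decidable P → P 0 → ∀ N → (∀ q → P q → q ≤ N) →
            ∃ λ q → P q × (∀ q′ → P q′ → q′ ≤ q)
∃-largest P? P0 zero    bounded = 0 , P0 , bounded
∃-largest P? P0 (suc N) bounded with P? (suc N)
... | yes PN = suc N , PN , bounded
... | no ¬PN = ∃-largest P? P0 N λ q Pq →
  m<1+n⇒m≤n (≤∧≢⇒< (bounded q Pq) λ { refl → ¬PN Pq })

*-distribʳ-+₃ : ∀ a₁ a₂ a₃ s → (a₁ + a₂ + a₃) * s ≡ a₁ * s + a₂ * s + a₃ * s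
*-distribʳ-+₃ a₁ a₂ a₃ s = solve (a₁ ∷ a₂ ∷ a₃ ∷ s ∷ [])

more-of-larger-generator-is-cheaper : ∀ {s₁ s₂} .{{_ : NonZero s₁}} → s₁ ≤ s₂ →
  ∀ {a₁ a₂ b₁ b₂} → b₂ ≤ a₂ → a₁ * s₁ + a₂ * s₂ ≡ b₁ * s₁ + b₂ * s₂ → a₁ + a₂ ≤ b₁ + b₂
more-of-larger-generator-is-cheaper {s₁} {s₂} s₁≤s₂ {a₁} {_} {b₁} {b₂} b₂≤a₂ eq
  with m≤n⇒∃[o]m+o≡n b₂≤a₂
... | d , refl = begin
  a₁ + (b₂ + d)  ≡⟨ regroup-cost ⟩
  a₁ + d + b₂    ≤⟨ +-monoˡ-≤ b₂ (*-cancelʳ-≤ (a₁ + d) b₁ s₁ a₁+d≤b₁) ⟩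
  b₁ + b₂        ∎
  where
  open ≤-Reasoning
  regroup-cost : a₁ + (b₂ + d) ≡ a₁ + d + b₂
  regroup-cost = solve (a₁ ∷ b₂ ∷ d ∷ [])
  regroup-value : a₁ * s₁ + d * s₂ + b₂ * s₂ ≡ a₁ * s₁ + (b₂ + d) * s₂
  regroup-value = solve (a₁ ∷ b₂ ∷ d ∷ s₁ ∷ s₂ ∷ [])
  a₁+d≤b₁ : (a₁ + d) * s₁ ≤ b₁ * s₁
  a₁+d≤b₁ = begin
    (a₁ + d) * s₁     ≡⟨ *-distribʳ-+ s₁ a₁ d ⟩
    a₁ * s₁ + d * s₁  ≤⟨ +-monoʳ-≤ (a₁ * s₁) (*-monoʳ-≤ d s₁≤s₂) ⟩
    a₁ * s₁ + d * s₂  ≡⟨ +-cancelʳ-≡ (b₂ * s₂) _ _ (trans regroup-value eq) ⟩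
    b₁ * s₁           ∎

module ThreeGenerators (s₁ s₂ s₃ : ℕ) (0<s₁ : 0 < s₁) (s₁≤s₂ : s₁ ≤ s₂) (s₂≤s₃ : s₂ ≤ s₃)
  where

  0<s₂ : 0 < s₂
  0<s₂ = ≤-trans 0<s₁ s₁≤s₂

  0<s₃ : 0 < s₃
  0<s₃ = ≤-trans 0<s₂ s₂≤s₃

  instance
    s₁-nonZero : NonZero s₁
    s₁-nonZero = >-nonZero 0<s₁
    s₂-nonZero : NonZero s₂
    s₂-nonZero = >-nonZero 0<s₂
    s₃-nonZero : NonZero s₃
    s₃-nonZero = >-nonZero 0<s₃

  _∈S : ℕ → Set
  r ∈S = r ∈⟨ s₁ , s₂ , s₃ ⟩

  value : ℕ → ℕ → ℕ → ℕ
  value a₁ a₂ a₃ = a₁ * s₁ + a₂ * s₂ + a₃ * s₃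

  cost : ℕ → ℕ → ℕ → ℕ
  cost a₁ a₂ a₃ = a₁ + a₂ + a₃

  record Rep (k a₁ a₂ a₃ : ℕ) : Set where
    constructor rep
    field value≡ : value a₁ a₂ a₃ ≡ k

  Adm : ℕ → ℕ → ℕ → Set
  Adm = Admissible s₁ s₂ s₃

  record Largest (s r q : ℕ) : Set where
    constructor largest
    field
      admissible : Adm s r q
      maximal    : ∀ q′ → Adm s r q′ → q′ ≤ q

  record IsMinRep (k b₁ b₂ b₃ : ℕ) : Set where
    field
      isRep   : Rep k b₁ b₂ b₃
      minimal : ∀ {c₁ c₂ c₃} → Rep k c₁ c₂ c₃ → cost b₁ b₂ b₃ ≤ cost c₁ c₂ c₃

  record IsGreedyRep (k a₁ a₂ a₃ : ℕ) : Set where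
    constructor greedy
    field
      largest₃ : Largest s₃ k a₃
      largest₂ : Largest s₂ (k ∸ a₃ * s₃) a₂
      largest₁ : Largest s₁ (k ∸ a₃ * s₃ ∸ a₂ * s₂) a₁

  open IsMinRep
  open IsGreedyRep

  unit₁ : Rep s₁ 1 0 0
  unit₁ = rep (trans (+-identityʳ _) (trans (+-identityʳ _) (+-identityʳ s₁)))

  unit₂ : Rep s₂ 0 1 0
  unit₂ = rep (trans (+-identityʳ _) (+-identityʳ s₂))

  unit₃ : Rep s₃ 0 0 1
  unit₃ = rep (+-identityʳ s₃)

  value-+ : ∀ u₁ u₂ u₃ c₁ c₂ c₃ →
            value (u₁ + c₁) (u₂ + c₂) (u₃ + c₃) ≡ value u₁ u₂ u₃ + value c₁ c₂ c₃
  value-+ u₁ u₂ u₃ c₁ c₂ c₃ = distribute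
    where
    distribute : (u₁ + c₁) * s₁ + (u₂ + c₂) * s₂ + (u₃ + c₃) * s₃
               ≡ (u₁ * s₁ + u₂ * s₂ + u₃ * s₃) + (c₁ * s₁ + c₂ * s₂ + c₃ * s₃)
    distribute = solve (u₁ ∷ u₂ ∷ u₃ ∷ c₁ ∷ c₂ ∷ c₃ ∷ s₁ ∷ s₂ ∷ s₃ ∷ [])

  cost-+ : ∀ u₁ u₂ u₃ c₁ c₂ c₃ →
           cost (u₁ + c₁) (u₂ + c₂) (u₃ + c₃) ≡ cost u₁ u₂ u₃ + cost c₁ c₂ c₃
  cost-+ u₁ u₂ u₃ c₁ c₂ c₃ = regroup
    where
    regroup : u₁ + c₁ + (u₂ + c₂) + (u₃ + c₃) ≡ (u₁ + u₂ + u₃) + (c₁ + c₂ + c₃)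
    regroup = solve (u₁ ∷ u₂ ∷ u₃ ∷ c₁ ∷ c₂ ∷ c₃ ∷ [])

  rep-split : ∀ {t k u₁ u₂ u₃ c₁ c₂ c₃} → Rep t u₁ u₂ u₃ → Rep k (u₁ + c₁) (u₂ + c₂) (u₃ + c₃) →
              k ≡ t + value c₁ c₂ c₃
  rep-split {u₁ = u₁} {u₂} {u₃} {c₁} {c₂} {c₃} (rep u) (rep uc) =
    trans (sym uc) (trans (value-+ u₁ u₂ u₃ c₁ c₂ c₃) (cong (_+ value c₁ c₂ c₃) u))

  rep-cancel : ∀ {t k u₁ u₂ u₃ a₁ a₂ a₃ b₁ b₂ b₃} → Rep t u₁ u₂ u₃ →
               Rep k (u₁ + a₁) (u₂ + a₂) (u₃ + a₃) → Rep k (u₁ + b₁) (u₂ + b₂) (u₃ + b₃) →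
               Rep (value b₁ b₂ b₃) a₁ a₂ a₃
  rep-cancel {t} u ua ub = rep (+-cancelˡ-≡ t _ _ (trans (sym (rep-split u ua)) (rep-split u ub)))

  rep-join : ∀ {t k u₁ u₂ u₃ b₁ b₂ b₃ c₁ c₂ c₃} → Rep t u₁ u₂ u₃ →
             Rep k (u₁ + b₁) (u₂ + b₂) (u₃ + b₃) → Rep (value b₁ b₂ b₃) c₁ c₂ c₃ →
             Rep k (u₁ + c₁) (u₂ + c₂) (u₃ + c₃)
  rep-join {u₁ = u₁} {u₂} {u₃} {c₁ = c₁} {c₂} {c₃} u ub (rep c) =
    rep (trans (value-+ u₁ u₂ u₃ c₁ c₂ c₃)
               (trans (cong₂ _+_ (Rep.value≡ u) c) (sym (rep-split u ub))))

  rep-tail-< : ∀ {t k u₁ u₂ u₃ c₁ c₂ c₃} → 0 < t → Rep t u₁ u₂ u₃ →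
               Rep k (u₁ + c₁) (u₂ + c₂) (u₃ + c₃) → value c₁ c₂ c₃ < k
  rep-tail-< {c₁ = c₁} {c₂} {c₃} 0<t u uc =
    subst (value c₁ c₂ c₃ <_) (sym (rep-split u uc)) (m<n+m _ 0<t)

  cost*s₁≤value : ∀ a₁ a₂ a₃ → cost a₁ a₂ a₃ * s₁ ≤ value a₁ a₂ a₃
  cost*s₁≤value a₁ a₂ a₃ = begin
    (a₁ + a₂ + a₃) * s₁          ≡⟨ *-distribʳ-+₃ a₁ a₂ a₃ s₁ ⟩
    a₁ * s₁ + a₂ * s₁ + a₃ * s₁  ≤⟨ +-mono-≤ (+-monoʳ-≤ (a₁ * s₁) (*-monoʳ-≤ a₂ s₁≤s₂))
                                             (*-monoʳ-≤ a₃ (≤-trans s₁≤s₂ s₂≤s₃)) ⟩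
    value a₁ a₂ a₃               ∎
    where open ≤-Reasoning

  value≤cost*s₃ : ∀ a₁ a₂ a₃ → value a₁ a₂ a₃ ≤ cost a₁ a₂ a₃ * s₃
  value≤cost*s₃ a₁ a₂ a₃ = begin
    value a₁ a₂ a₃               ≤⟨ +-monoˡ-≤ (a₃ * s₃) (+-mono-≤ (*-monoʳ-≤ a₁ (≤-trans s₁≤s₂ s₂≤s₃))
                                                                  (*-monoʳ-≤ a₂ s₂≤s₃)) ⟩
    a₁ * s₃ + a₂ * s₃ + a₃ * s₃  ≡⟨ sym (*-distribʳ-+₃ a₁ a₂ a₃ s₃) ⟩
    (a₁ + a₂ + a₃) * s₃          ∎
    where open ≤-Reasoning

  rep⇒cost≤ : ∀ {r a₁ a₂ a₃} → Rep r a₁ a₂ a₃ → cost a₁ a₂ a₃ ≤ r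
  rep⇒cost≤ {a₁ = a₁} {a₂} {a₃} (rep refl) =
    ≤-trans (m≤m*n (cost a₁ a₂ a₃) s₁) (cost*s₁≤value a₁ a₂ a₃)

  only-s₁-rep-is-costliest : ∀ {k b₁ a₁ a₂ a₃} → Rep k b₁ 0 0 → Rep k a₁ a₂ a₃ →
                             cost a₁ a₂ a₃ ≤ cost b₁ 0 0
  only-s₁-rep-is-costliest {b₁ = b₁} {a₁} {a₂} {a₃} (rep b) (rep a) =
    *-cancelʳ-≤ (cost a₁ a₂ a₃) (cost b₁ 0 0) s₁ (begin
    cost a₁ a₂ a₃ * s₁  ≤⟨ cost*s₁≤value a₁ a₂ a₃ ⟩
    value a₁ a₂ a₃      ≡⟨ trans a (sym b) ⟩
    value b₁ 0 0        ≡⟨ only-s₁ ⟩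
    cost b₁ 0 0 * s₁    ∎)
    where
    open ≤-Reasoning
    only-s₁ : b₁ * s₁ + 0 * s₂ + 0 * s₃ ≡ (b₁ + 0 + 0) * s₁
    only-s₁ = solve (b₁ ∷ s₁ ∷ s₂ ∷ s₃ ∷ [])

  only-s₃-rep-is-cheapest : ∀ {k a₃ b₁ b₂ b₃} → Rep k 0 0 a₃ → Rep k b₁ b₂ b₃ → a₃ ≤ cost b₁ b₂ b₃
  only-s₃-rep-is-cheapest {a₃ = a₃} {b₁} {b₂} {b₃} (rep a) (rep b) =
    *-cancelʳ-≤ a₃ (cost b₁ b₂ b₃) s₃ (begin
    a₃ * s₃              ≡⟨ trans a (sym b) ⟩
    value b₁ b₂ b₃       ≤⟨ value≤cost*s₃ b₁ b₂ b₃ ⟩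
    cost b₁ b₂ b₃ * s₃   ∎)
    where open ≤-Reasoning

  _∈S? : Decidable _∈S
  r ∈S? = map′ (λ (a₁ , _ , a₂ , _ , a₃ , _ , a) → a₁ , a₂ , a₃ , a) bounded
    (anyUpTo? (λ a₁ → anyUpTo? (λ a₂ → anyUpTo? (λ a₃ → value a₁ a₂ a₃ ≟ r) (suc r)) (suc r)) (suc r))
    where
    bounded : r ∈S →
              ∃ λ a₁ → a₁ < suc r × ∃ λ a₂ → a₂ < suc r × ∃ λ a₃ → a₃ < suc r × value a₁ a₂ a₃ ≡ r
    bounded (a₁ , a₂ , a₃ , a) =
      a₁ , s≤s (≤-trans (≤-trans (m≤m+n a₁ a₂) (m≤m+n _ a₃)) cost≤r) ,
      a₂ , s≤s (≤-trans (≤-trans (m≤n+m a₂ a₁) (m≤m+n _ a₃)) cost≤r) ,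
      a₃ , s≤s (≤-trans (m≤n+m a₃ (a₁ + a₂)) cost≤r) , a
      where
      cost≤r : cost a₁ a₂ a₃ ≤ r
      cost≤r = rep⇒cost≤ {a₁ = a₁} {a₂} {a₃} (rep a)

  admissible? : ∀ s r → Decidable (Adm s r)
  admissible? s r q = (q * s ≤? r) ×-dec ((r ∸ q * s) ∈S?)

  admissible-split : ∀ s q {t} → t ∈S → Adm s (q * s + t) q
  admissible-split s q {t} t∈S = m≤m+n (q * s) t , subst _∈S (sym (m+n∸m≡n (q * s) t)) t∈S

  admissible-suc : ∀ {s r q} → Adm s r q → Adm s (s + r) (suc q)
  admissible-suc {s} {r} {q} (qs≤r , rest) =
    +-monoʳ-≤ s qs≤r , subst _∈S (sym ([m+n]∸[m+o]≡n∸o s r (q * s))) rest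

  admissible-suc⁻¹ : ∀ {s r q} → Adm s (s + r) (suc q) → Adm s r q
  admissible-suc⁻¹ {s} {r} {q} (qs≤r , rest) =
    +-cancelˡ-≤ s _ _ qs≤r , subst _∈S ([m+n]∸[m+o]≡n∸o s r (q * s)) rest

  largest-suc⁻¹ : ∀ {s r q} → Largest s (s + r) (suc q) → Largest s r q
  largest-suc⁻¹ {s} {r} {q} (largest adm max) =
    largest (admissible-suc⁻¹ {s} {r} {q} adm)
            λ q′ adm′ → s≤s⁻¹ (max (suc q′) (admissible-suc {s} {r} {q′} adm′))

  largest-exists : ∀ s .{{_ : NonZero s}} {r} → r ∈S → ∃ (Largest s r)
  largest-exists s {r} r∈S
    with ∃-largest (admissible? s r) (z≤n , r∈S) r (λ q adm → ≤-trans (m≤m*n q s) (proj₁ adm))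
  ... | q , adm , max = q , largest adm max

  largest-split : ∀ {s r q t} → Largest s r q → r ∸ q * s ≡ t → r ≡ q * s + t
  largest-split (largest (qs≤r , _) _) refl = sym (m+[n∸m]≡n qs≤r)

  largest-remainder-∈ : ∀ {s r q} → Largest s r q → (r ∸ q * s) ∈S
  largest-remainder-∈ (largest (_ , rest) _) = rest

  largest⇒remainder≢s+ : ∀ {s r q t} → Largest s r q → r ∸ q * s ≡ s + t → ¬ t ∈S
  largest⇒remainder≢s+ {s} {r} {q} {t} L rest t∈S =
    1+n≰n (Largest.maximal L (suc q) suc-q-admissible)
    where
    r≡ : r ≡ suc q * s + t
    r≡ = trans (largest-split L rest)
               (trans (sym (+-assoc (q * s) s t)) (cong (_+ t) (+-comm (q * s) s)))
    suc-q-admissible : Adm s r (suc q)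
    suc-q-admissible = subst (λ n → Adm s n (suc q)) (sym r≡) (admissible-split s (suc q) t∈S)

  rep⇒admissible₂ : ∀ {r b₁ b₂ b₃} → Rep r b₁ b₂ b₃ → Adm s₂ r b₂
  rep⇒admissible₂ {b₁ = b₁} {b₂} {b₃} (rep refl) =
    subst (λ n → Adm s₂ n b₂) (sym reorder) (admissible-split s₂ b₂ (b₁ , 0 , b₃ , refl))
    where
    reorder : b₁ * s₁ + b₂ * s₂ + b₃ * s₃ ≡ b₂ * s₂ + (b₁ * s₁ + 0 * s₂ + b₃ * s₃)
    reorder = solve (b₁ ∷ b₂ ∷ b₃ ∷ s₁ ∷ s₂ ∷ s₃ ∷ [])

  rep⇒admissible₃ : ∀ {r b₁ b₂ b₃} → Rep r b₁ b₂ b₃ → Adm s₃ r b₃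
  rep⇒admissible₃ {b₁ = b₁} {b₂} {b₃} (rep refl) =
    subst (λ n → Adm s₃ n b₃) (sym reorder) (admissible-split s₃ b₃ (b₁ , b₂ , 0 , refl))
    where
    reorder : b₁ * s₁ + b₂ * s₂ + b₃ * s₃ ≡ b₃ * s₃ + (b₁ * s₁ + b₂ * s₂ + 0 * s₃)
    reorder = solve (b₁ ∷ b₂ ∷ b₃ ∷ s₁ ∷ s₂ ∷ s₃ ∷ [])

  greedy-exists : ∀ {k} → k ∈S → ∃ λ a₁ → ∃ λ a₂ → ∃ λ a₃ → IsGreedyRep k a₁ a₂ a₃
  greedy-exists k∈S with largest-exists s₃ k∈S
  ... | a₃ , L₃ with largest-exists s₂ (largest-remainder-∈ L₃)
  ... | a₂ , L₂ with largest-exists s₁ (largest-remainder-∈ L₂)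
  ... | a₁ , L₁ = a₁ , a₂ , a₃ , greedy L₃ L₂ L₁

  greedy⇒rep : ∀ {k a₁ a₂ a₃} → IsGreedyRep k a₁ a₂ a₃ → Rep k a₁ a₂ a₃
  greedy⇒rep {k} {a₁} {a₂} {a₃} (greedy L₃ L₂ L₁) with largest-remainder-∈ L₁
  ... | suc c₁ , c₂ , c₃ , r₀≡ =
    contradiction (c₁ , c₂ , c₃ , refl) (largest⇒remainder≢s+ L₁ (trans (sym r₀≡) peel))
    where
    peel : suc c₁ * s₁ + c₂ * s₂ + c₃ * s₃ ≡ s₁ + (c₁ * s₁ + c₂ * s₂ + c₃ * s₃)
    peel = solve (c₁ ∷ c₂ ∷ c₃ ∷ s₁ ∷ s₂ ∷ s₃ ∷ [])
  ... | zero , suc c₂ , c₃ , r₀≡ =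
    contradiction (a₁ , c₂ , c₃ , refl) (largest⇒remainder≢s+ L₂ r₁≡)
    where
    peel : a₁ * s₁ + (0 * s₁ + suc c₂ * s₂ + c₃ * s₃) ≡ s₂ + (a₁ * s₁ + c₂ * s₂ + c₃ * s₃)
    peel = solve (a₁ ∷ c₂ ∷ c₃ ∷ s₁ ∷ s₂ ∷ s₃ ∷ [])
    r₁≡ : k ∸ a₃ * s₃ ∸ a₂ * s₂ ≡ s₂ + value a₁ c₂ c₃
    r₁≡ = trans (largest-split L₁ (sym r₀≡)) peel
  ... | zero , zero , suc c₃ , r₀≡ =
    contradiction (a₁ , a₂ , c₃ , refl) (largest⇒remainder≢s+ L₃ r₂≡)
    where
    peel : a₂ * s₂ + (a₁ * s₁ + (0 * s₁ + 0 * s₂ + suc c₃ * s₃)) ≡ s₃ + (a₁ * s₁ + a₂ * s₂ + c₃ * s₃)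
    peel = solve (a₁ ∷ a₂ ∷ c₃ ∷ s₁ ∷ s₂ ∷ s₃ ∷ [])
    r₂≡ : k ∸ a₃ * s₃ ≡ s₃ + value a₁ a₂ c₃
    r₂≡ = trans (largest-split L₂ (largest-split L₁ (sym r₀≡))) peel
  ... | zero , zero , zero , r₀≡ =
    rep (sym (trans (largest-split L₃ (largest-split L₂ (largest-split L₁ (sym r₀≡)))) collect))
    where
    collect : a₃ * s₃ + (a₂ * s₂ + (a₁ * s₁ + (0 * s₁ + 0 * s₂ + 0 * s₃))) ≡ a₁ * s₁ + a₂ * s₂ + a₃ * s₃
    collect = solve (a₁ ∷ a₂ ∷ a₃ ∷ s₁ ∷ s₂ ∷ s₃ ∷ [])

  greedy-suc⁻¹ : ∀ {k a₁ a₂ a₃} → IsGreedyRep (s₃ + k) a₁ a₂ (suc a₃) → IsGreedyRep k a₁ a₂ a₃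
  greedy-suc⁻¹ {k} {a₁} {a₂} {a₃} (greedy L₃ L₂ L₁) =
    greedy (largest-suc⁻¹ L₃) (subst (λ r → Largest s₂ r a₂) remainder L₂)
                              (subst (λ r → Largest s₁ (r ∸ a₂ * s₂) a₁) remainder L₁)
    where
    remainder : s₃ + k ∸ suc a₃ * s₃ ≡ k ∸ a₃ * s₃
    remainder = [m+n]∸[m+o]≡n∸o s₃ k (a₃ * s₃)

  greedy-maximises-s₃ : ∀ {k a₁ a₂ a₃ b₁ b₂ b₃} → IsGreedyRep k a₁ a₂ a₃ → Rep k b₁ b₂ b₃ → b₃ ≤ a₃
  greedy-maximises-s₃ {b₃ = b₃} A b = Largest.maximal (largest₃ A) b₃ (rep⇒admissible₃ b)

  greedy-optimal-for-fixed-s₃ : ∀ {k a₁ a₂ a₃ b₁ b₂} → IsGreedyRep k a₁ a₂ a₃ → Rep k b₁ b₂ a₃ →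
                                cost a₁ a₂ a₃ ≤ cost b₁ b₂ a₃
  greedy-optimal-for-fixed-s₃ {k} {a₁} {a₂} {a₃} {b₁} {b₂} A (rep b) =
    +-monoˡ-≤ a₃ (more-of-larger-generator-is-cheaper s₁≤s₂
      (Largest.maximal (largest₂ A) b₂ (rep⇒admissible₂ remainder-rep)) same-value)
    where
    remainder-rep : Rep (k ∸ a₃ * s₃) b₁ b₂ 0
    remainder-rep =
      rep (trans (+-identityʳ _) (trans (sym (m+n∸n≡m _ (a₃ * s₃))) (cong (_∸ a₃ * s₃) b)))
    same-value : a₁ * s₁ + a₂ * s₂ ≡ b₁ * s₁ + b₂ * s₂
    same-value = +-cancelʳ-≡ (a₃ * s₃) _ _ (trans (Rep.value≡ (greedy⇒rep A)) (sym b))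

  min-rep-split : ∀ {t k u₁ u₂ u₃ c₁ c₂ c₃} → Rep t u₁ u₂ u₃ →
                  IsMinRep k (u₁ + c₁) (u₂ + c₂) (u₃ + c₃) → IsMinRep (value c₁ c₂ c₃) c₁ c₂ c₃
  min-rep-split {u₁ = u₁} {u₂} {u₃} {c₁} {c₂} {c₃} u M = record
    { isRep   = rep refl
    ; minimal = λ {d₁} {d₂} {d₃} d → +-cancelˡ-≤ (cost u₁ u₂ u₃) _ _ (subst₂ _≤_
        (cost-+ u₁ u₂ u₃ c₁ c₂ c₃) (cost-+ u₁ u₂ u₃ d₁ d₂ d₃)
        (minimal M (rep-join u (isRep M) d)))
    }

  GreedyOptimal : ℕ → Set
  GreedyOptimal k = ∀ {a₁ a₂ a₃ c₁ c₂ c₃} → IsGreedyRep k a₁ a₂ a₃ → IsMinRep k c₁ c₂ c₃ →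
                    cost a₁ a₂ a₃ ≤ cost c₁ c₂ c₃

  greedy-optimal-below : ∀ {k} →
    (∀ k′ → 0 < k′ → k′ < k → k′ ∈S → ∀ m′ g′ →
      IsMinCost s₁ s₂ s₃ k′ m′ → IsGreedyCost s₁ s₂ s₃ k′ g′ → ¬ (m′ < g′)) →
    ∀ {k′} → k′ < k → GreedyOptimal k′
  greedy-optimal-below _ {zero} _ A _ = ≤-trans (rep⇒cost≤ (greedy⇒rep A)) z≤n
  greedy-optimal-below no-smaller {suc k′} k′<k {a₁} {a₂} {a₃} {c₁} {c₂} {c₃}
                       (greedy (largest adm₃ max₃) (largest adm₂ max₂) (largest adm₁ max₁)) C =
    ≮⇒≥ (no-smaller (suc k′) z<s k′<k (c₁ , c₂ , c₃ , c) (cost c₁ c₂ c₃) (cost a₁ a₂ a₃)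
          ((c₁ , c₂ , c₃ , c , refl) , λ d₁ d₂ d₃ d → minimal C {d₁} {d₂} {d₃} (rep d))
          (a₃ , a₂ , a₁ , (adm₃ , max₃) , (adm₂ , max₂) , (adm₁ , max₁) , refl))
    where
    c : value c₁ c₂ c₃ ≡ suc k′
    c = Rep.value≡ (isRep C)

  module MinimalCounterexample {k} (optimal-below : ∀ {k′} → k′ < k → GreedyOptimal k′) where

    min-rep-using-s₃⇒greedy-optimal : ∀ {a₁ a₂ a₃ c₁ c₂ c₃} → IsGreedyRep k a₁ a₂ (suc a₃) →
      IsMinRep k c₁ c₂ (suc c₃) → cost a₁ a₂ (suc a₃) ≤ cost c₁ c₂ (suc c₃)
    min-rep-using-s₃⇒greedy-optimal {a₁} {a₂} {a₃} {c₁} {c₂} {c₃} A C = begin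
      cost a₁ a₂ (suc a₃)  ≡⟨ cost-+ 0 0 1 a₁ a₂ a₃ ⟩
      1 + cost a₁ a₂ a₃    ≤⟨ s≤s (optimal-below k−s₃<k A′ (min-rep-split unit₃ C)) ⟩
      1 + cost c₁ c₂ c₃    ≡⟨ sym (cost-+ 0 0 1 c₁ c₂ c₃) ⟩
      cost c₁ c₂ (suc c₃)  ∎
      where
      open ≤-Reasoning
      k−s₃<k : value c₁ c₂ c₃ < k
      k−s₃<k = rep-tail-< 0<s₃ unit₃ (isRep C)
      A′ : IsGreedyRep (value c₁ c₂ c₃) a₁ a₂ a₃
      A′ = greedy-suc⁻¹ (subst (λ n → IsGreedyRep n a₁ a₂ (suc a₃)) (rep-split unit₃ (isRep C)) A)

    -- The greedy representation of k − t uses s₃ because a − u does, and is optimal by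
    -- minimality of k; adding u back to it yields a minimum-cost representation of k using s₃.
    shared-generator⇒greedy-optimal : ∀ {t u₁ u₂ a₁ a₂ a₃ b₁ b₂ b₃} → 0 < t → Rep t u₁ u₂ 0 →
      IsGreedyRep k (u₁ + a₁) (u₂ + a₂) (suc a₃) → IsMinRep k (u₁ + b₁) (u₂ + b₂) b₃ →
      cost (u₁ + a₁) (u₂ + a₂) (suc a₃) ≤ cost (u₁ + b₁) (u₂ + b₂) b₃
    shared-generator⇒greedy-optimal {u₁ = u₁} {u₂} {a₁} {a₂} {a₃} {b₁} {b₂} {b₃} 0<t u A B =
      via-greedy-of-tail (greedy-exists (b₁ , b₂ , b₃ , refl))
      where
      k−t<k : value b₁ b₂ b₃ < k
      k−t<k = rep-tail-< 0<t u (isRep B)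
      via-greedy-of-tail : (∃ λ c₁ → ∃ λ c₂ → ∃ λ c₃ → IsGreedyRep (value b₁ b₂ b₃) c₁ c₂ c₃) →
                           cost (u₁ + a₁) (u₂ + a₂) (suc a₃) ≤ cost (u₁ + b₁) (u₂ + b₂) b₃
      via-greedy-of-tail (c₁ , c₂ , zero , C) =
        contradiction (greedy-maximises-s₃ C (rep-cancel u (greedy⇒rep A) (isRep B))) λ ()
      via-greedy-of-tail (c₁ , c₂ , suc c₃ , C) = ≤-trans (min-rep-using-s₃⇒greedy-optimal A D) D≤B
        where
        open ≤-Reasoning
        D≤B : cost (u₁ + c₁) (u₂ + c₂) (suc c₃) ≤ cost (u₁ + b₁) (u₂ + b₂) b₃
        D≤B = begin
          cost (u₁ + c₁) (u₂ + c₂) (suc c₃)  ≡⟨ cost-+ u₁ u₂ 0 c₁ c₂ (suc c₃) ⟩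
          cost u₁ u₂ 0 + cost c₁ c₂ (suc c₃)  ≤⟨ +-monoʳ-≤ (cost u₁ u₂ 0)
                                                  (optimal-below k−t<k C (min-rep-split u B)) ⟩
          cost u₁ u₂ 0 + cost b₁ b₂ b₃        ≡⟨ sym (cost-+ u₁ u₂ 0 b₁ b₂ b₃) ⟩
          cost (u₁ + b₁) (u₂ + b₂) b₃         ∎
        D : IsMinRep k (u₁ + c₁) (u₂ + c₂) (suc c₃)
        D = record { isRep   = rep-join u (isRep B) (greedy⇒rep C)
                   ; minimal = λ e → ≤-trans D≤B (minimal B e) }

    shape : ∀ {b₁ b₂ b₃ a₁ a₂ a₃} → IsMinRep k b₁ b₂ b₃ → IsGreedyRep k a₁ a₂ a₃ →
            cost b₁ b₂ b₃ < cost a₁ a₂ a₃ →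
            ∃ λ x → ∃ λ y → ∃ λ z → 0 < x × 0 < y × 0 < z ×
              s₁ * x + s₃ * z ≡ s₂ * y × y < x + z × k ≡ s₂ * y
    shape {b₃ = zero} {a₃ = zero} B A b<a =
      contradiction (greedy-optimal-for-fixed-s₃ A (isRep B)) (<⇒≱ b<a)
    shape {b₃ = suc _} {a₃ = zero} B A _ =
      contradiction (greedy-maximises-s₃ A (isRep B)) λ ()
    shape {b₃ = suc _} {a₃ = suc _} B A b<a =
      contradiction (min-rep-using-s₃⇒greedy-optimal A B) (<⇒≱ b<a)
    shape {b₂ = suc _} {b₃ = zero} {a₂ = suc _} {a₃ = suc _} B A b<a =
      contradiction (shared-generator⇒greedy-optimal 0<s₂ unit₂ A B) (<⇒≱ b<a)
    shape {b₁ = suc _} {b₃ = zero} {a₁ = suc _} {a₃ = suc _} B A b<a =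
      contradiction (shared-generator⇒greedy-optimal 0<s₁ unit₁ A B) (<⇒≱ b<a)
    shape {b₂ = zero} {b₃ = zero} B A b<a =
      contradiction (only-s₁-rep-is-costliest (isRep B) (greedy⇒rep A)) (<⇒≱ b<a)
    shape {b₃ = zero} {a₁ = zero} {a₂ = zero} {a₃ = suc _} B A b<a =
      contradiction (only-s₃-rep-is-cheapest (greedy⇒rep A) (isRep B)) (<⇒≱ b<a)
    shape {b₁ = zero} {suc y} {zero} {suc x} {zero} {suc z} B A b<a =
      suc x , suc y , suc z , z<s , z<s , z<s , s₁x+s₃z≡s₂y , y<x+z , k≡s₂y
      where
      k≡s₂y : k ≡ s₂ * suc y
      k≡s₂y = trans (sym (Rep.value≡ (isRep B))) (trans (+-identityʳ _) (*-comm (suc y) s₂))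
      reorder : s₁ * suc x + s₃ * suc z ≡ suc x * s₁ + 0 * s₂ + suc z * s₃
      reorder = solve (x ∷ z ∷ s₁ ∷ s₂ ∷ s₃ ∷ [])
      s₁x+s₃z≡s₂y : s₁ * suc x + s₃ * suc z ≡ s₂ * suc y
      s₁x+s₃z≡s₂y = trans reorder (trans (Rep.value≡ (greedy⇒rep A)) k≡s₂y)
      y<x+z : suc y < suc x + suc z
      y<x+z = subst₂ _<_ (+-identityʳ (suc y)) (cong (_+ suc z) (+-identityʳ (suc x))) b<a

lemma4 : (s₁ s₂ s₃ : ℕ) → 1 < s₁ → s₁ < s₂ → s₂ < s₃ → gcd (gcd s₁ s₂) s₃ ≡ 1 →
    ¬ IsGreedySemigroup s₁ s₂ s₃ →
    (k m g : ℕ) → 0 < k → k ∈⟨ s₁ , s₂ , s₃ ⟩ →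
    IsMinCost s₁ s₂ s₃ k m → IsGreedyCost s₁ s₂ s₃ k g → m < g →
    (∀ k' → 0 < k' → k' < k → k' ∈⟨ s₁ , s₂ , s₃ ⟩ → ∀ m' g' →
      IsMinCost s₁ s₂ s₃ k' m' → IsGreedyCost s₁ s₂ s₃ k' g' → ¬ (m' < g')) →
    ∃ λ x → ∃ λ y → ∃ λ z → 0 < x × 0 < y × 0 < z ×
      s₁ * x + s₃ * z ≡ s₂ * y × y < x + z × k ≡ s₂ * y
lemma4 s₁ s₂ s₃ 1<s₁ s₁<s₂ s₂<s₃ _ _ k _ _ _ _ ((b₁ , b₂ , b₃ , b , refl) , b-min)
       (a₃ , a₂ , a₁ , (adm₃ , max₃) , (adm₂ , max₂) , (adm₁ , max₁) , refl) b<a no-smaller =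
  shape B A b<a
  where
  open ThreeGenerators s₁ s₂ s₃ (<⇒≤ 1<s₁) (<⇒≤ s₁<s₂) (<⇒≤ s₂<s₃)
  open MinimalCounterexample (greedy-optimal-below no-smaller)
  B : IsMinRep k b₁ b₂ b₃
  B = record { isRep = rep b ; minimal = λ {c₁} {c₂} {c₃} c → b-min c₁ c₂ c₃ (Rep.value≡ c) }
  A : IsGreedyRep k a₁ a₂ a₃
  A = greedy (largest adm₃ max₃) (largest adm₂ max₂) (largest adm₁ max₁)
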